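{- Let $L$ be the language with a unary predicate $U_\sigma$ for every finite string $\sigma \in \omega^{<\omega}$ and a binary relation $B_{\sigma,\tau}$ for every pair of strings $\sigma,\tau \in \omega^{<\omega}$ of the same length, and let $T$ be the $L$-theory given below. Let $M = \prod_{i \to \mathcal{U}} M_i$ be an ultraproduct of finite $L$-structures with $M \models T$. Let $h \in \omega^\omega$ and for each $n$ let $\sigma_n$ be the initial segment of $h$ of length $n$. Then $\delta(M) > \delta(U_{\sigma_1}(M)) > \delta(U_{\sigma_2}(M)) > \cdots$. In particular, $M$ fails to satisfy the GMS condition (SA).
   Context: The theory $T$ consists of: (a) $U_\emptyset$ is the whole universe; (b) $U_\sigma \neq \emptyset$ for each string $\sigma$; (c) $U_\sigma \supset U_\tau$ whenever $\sigma$ is an initial segment of $\tau$; (d) $U_{\sigma i} \cap U_{\sigma j} = \emptyset$ for each string $\sigma$ and distinct numbers $i,j$; (e) $B_{\sigma,\tau}$ is the graph of a bijection from $U_\sigma$ to $U_\tau$ for strings $\sigma,\tau$ of the same length; (f) $B_{\sigma,\tau}(x,y) \leftrightarrow B_{\tau,\sigma}(y,x)$; (g) if $B_{\sigma,\tau}(x,y)$ and $B_{\tau,\rho}(y,z)$ then $B_{\sigma,\rho}(x,z)$ (for $\sigma,\tau,\rho$ of the same length); (h) if $U_{\sigma i}(x)$ and $U_\tau(y)$ then $B_{\sigma,\tau}(x,y)$ holds iff $U_{\tau i}(y)$ and $B_{\sigma i,\tau i}(x,y)$ (for $\sigma,\tau$ of the same length and each number $i$). Pseudofinite cardinality: for $M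 = \prod_{i\to\mathcal{U}} M_i$ an ultraproduct of finite structures, $\mathbb{R}^\star = \prod_{i \to \mathcal{U}} \mathbb{R}$, and for a definable set $X = \varphi(M,\bar b)$ (with $\bar b = (\bar b_i)_{i\to\mathcal{U}}$), $|X| \in \mathbb{R}^\star$ is the class of $(|\varphi(M_i,\bar b_i)|)_i$. For definable $X,Y$, $\delta(X) < \delta(Y)$ means $n|X| < |Y|$ for every $n \in \mathbb{N}$. $M$ satisfies the GMS condition (SA) if there is no sequence of definable sets $M \supseteq X_1 \supset X_2 \supset \cdots$ with $\delta(X_i) > \delta(X_{i+1})$ for all $i$. -}

module Defs where

open import Data.Nat using (ℕ; zero; suc; _+_; _*_; _<_)
open import Data.Fin using (Fin; zero; suc; toℕ; _≟_)
open import Data.Vec using (Vec; []; _∷_; _∷ʳ_; _++_; tabulate)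
open import Data.Bool using (Bool; true; false; if_then_else_; not; _∧_; _∨_)
open import Data.Product using (Σ; _×_; _,_)
open import Data.Sum using (_⊎_)
open import Data.Unit using (⊤)
open import Data.Empty using (⊥)
open import Relation.Nullary using (¬_)
open import Relation.Nullary.Decidable using (⌊_⌋)
open import Relation.Binary.PropositionalEquality using (_≡_)

-- Strings σ ∈ ω^{<ω} of length n are Vec ℕ n.

record Str : Set where
  field
    size : ℕ
    U    : ∀ {n} → Vec ℕ n → Fin (suc size) → Bool
    B    : ∀ {n} → Vec ℕ n → Vec ℕ n → Fin (suc size) → Fin (suc size) → Bool

  Carrier : Set
  Carrier = Fin (suc size)

  card : ℕ
  card = suc size

open Str public

count : ∀ {N} → (Fin N → Bool) → ℕ
count {zero}  f = 0
count {suc N} f = (if f zero then 1 else 0) + count (λ a → f (suc a))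

cardU : (M : Str) → ∀ {n} → Vec ℕ n → ℕ
cardU M σ = count (U M σ)

record Ultrafilter (I : Set) : Set₁ where
  field
    Big       : (I → Set) → Set
  field
    whole     : Big (λ _ → ⊤)
    noEmpty   : ¬ (Big (λ _ → ⊥))
    upward    : ∀ (P Q : I → Set) → (∀ i → P i → Q i) → Big P → Big Q
    inter     : ∀ (P Q : I → Set) → Big P → Big Q → Big (λ i → P i × Q i)
    ultra     : ∀ (P : I → Set) → Big P ⊎ Big (λ i → ¬ P i)

open Ultrafilter public

module Ultraproduct {I : Set} (F : Ultrafilter I) (Ms : I → Str) where

  Most : (I → Set) → Set
  Most P = Big F P

  -- elements of the product (the ultraproduct is its quotient by _≈_)
  Elem : Set
  Elem = (i : I) → Carrier (Ms i)

  _≈_ : Elem → Elem → Set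
  x ≈ y = Most (λ i → x i ≡ y i)

  UM : ∀ {n} → Vec ℕ n → Elem → Set
  UM σ x = Most (λ i → U (Ms i) σ (x i) ≡ true)

  BM : ∀ {n} → Vec ℕ n → Vec ℕ n → Elem → Elem → Set
  BM σ τ x y = Most (λ i → B (Ms i) σ τ (x i) (y i) ≡ true)

  _⇔_ : Set → Set → Set
  A ⇔ A' = (A → A') × (A' → A)

  record ModelsT : Set where
    field
      ax-a : ∀ x → UM [] x
      ax-b : ∀ {n} (σ : Vec ℕ n) → Σ Elem (λ x → UM σ x)
      ax-c : ∀ {n k} (σ : Vec ℕ n) (ρ : Vec ℕ k) x → UM (σ ++ ρ) x → UM σ x
      ax-d : ∀ {n} (σ : Vec ℕ n) (i j : ℕ) → ¬ (i ≡ j) →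
               ∀ x → ¬ (UM (σ ∷ʳ i) x × UM (σ ∷ʳ j) x)
      ax-e-dom  : ∀ {n} (σ τ : Vec ℕ n) x y → BM σ τ x y → UM σ x × UM τ y
      ax-e-tot  : ∀ {n} (σ τ : Vec ℕ n) x → UM σ x → Σ Elem (λ y → BM σ τ x y)
      ax-e-fun  : ∀ {n} (σ τ : Vec ℕ n) x y y' → BM σ τ x y → BM σ τ x y' → y ≈ y'
      ax-e-inj  : ∀ {n} (σ τ : Vec ℕ n) x x' y → BM σ τ x y → BM σ τ x' y → x ≈ x'
      ax-e-surj : ∀ {n} (σ τ : Vec ℕ n) y → UM τ y → Σ Elem (λ x → BM σ τ x y)
      ax-f : ∀ {n} (σ τ : Vec ℕ n) x y → BM σ τ x y ⇔ BM τ σ y x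
      ax-g : ∀ {n} (σ τ ρ : Vec ℕ n) x y z → BM σ τ x y → BM τ ρ y z → BM σ ρ x z
      ax-h : ∀ {n} (σ τ : Vec ℕ n) (i : ℕ) x y → UM (σ ∷ʳ i) x → UM τ y →
               BM σ τ x y ⇔ (UM (τ ∷ʳ i) y × BM (σ ∷ʳ i) (τ ∷ʳ i) x y)

  -- δ(X) < δ(Y) for pseudofinite cardinalities |X| = [(X_i)_i], |Y| = [(Y_i)_i]:
  -- n|X| < |Y| in ℝ* = ∏_F ℝ for every n ∈ ℕ.
  δ<  : (I → ℕ) → (I → ℕ) → Set
  δ< X Y = ∀ (n : ℕ) → Most (λ i → n * X i < Y i)

data Formula (n : ℕ) : Set where
  rel-U : ∀ {k} → Vec ℕ k → Fin n → Formula n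
  rel-B : ∀ {k} → Vec ℕ k → Vec ℕ k → Fin n → Fin n → Formula n
  eqv   : Fin n → Fin n → Formula n
  neg   : Formula n → Formula n
  conj  : Formula n → Formula n → Formula n
  ex    : Formula (suc n) → Formula n

anyFin : ∀ {N} → (Fin N → Bool) → Bool
anyFin {zero}  f = false
anyFin {suc N} f = f zero ∨ anyFin (λ a → f (suc a))

extEnv : ∀ {A : Set} {n} → A → (Fin n → A) → Fin (suc n) → A
extEnv a e zero    = a
extEnv a e (suc j) = e j

eval : (M : Str) → ∀ {n} → Formula n → (Fin n → Carrier M) → Bool
eval M (rel-U σ v)     e = U M σ (e v)
eval M (rel-B σ τ v w) e = B M σ τ (e v) (e w)
eval M (eqv v w)       e = ⌊ e v ≟ e w ⌋
eval M (neg φ)         e = not (eval M φ e)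
eval M (conj φ ψ)      e = eval M φ e ∧ eval M ψ e
eval M (ex φ)          e = anyFin (λ a → eval M φ (extEnv a e))

module Definability {I : Set} (F : Ultrafilter I) (Ms : I → Str) where
  open Ultraproduct F Ms

  record Definable : Set where
    field
      arity  : ℕ
      φ      : Formula (suc arity)
      params : Fin arity → Elem

  open Definable public

  -- x ∈ φ(M, b̄)   (via Łoś: φ(x i, b̄_i) holds for F-most i)
  _∈D_ : Elem → Definable → Set
  x ∈D X = Most (λ i → eval (Ms i) (φ X) (extEnv (x i) (λ j → params X j i)) ≡ true)

  -- |X| ∈ ℝ*, represented by the sequence (|φ(M_i, b̄_i)|)_i
  cardD : Definable → I → ℕ
  cardD X i = count (λ a → eval (Ms i) (φ X) (extEnv a (λ j → params X j i)))

  SA : Set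
  SA = ¬ Σ (ℕ → Definable) (λ X →
         (∀ k x → x ∈D X (suc k) → x ∈D X k) ×
         (∀ k → δ< (cardD (X (suc k))) (cardD (X k))))

initSeg : (ℕ → ℕ) → (n : ℕ) → Vec ℕ n
initSeg h n = tabulate (λ j → h (toℕ j))

-- For F-most factors, the children U_{σ0}, …, U_{σn} of a node are pairwise disjoint subsets
-- of U_σ and B_{σc,σj} maps U_{σc} injectively into each of them, so (n+1)·|U_{σc}| ≤ |U_σ|;
-- as U_{σc} is nonempty, n·|U_{σc}| < |U_σ|.  Hence the sets U_{σ_k}(M) form a descending
-- chain of strictly decreasing δ, contradicting (SA).  Each property of M used is a universal
-- statement, and it transfers to F-most factors because a finite factor in which it fails
-- contains a counterexample.
module Submission where

open import Defs
open import Data.Nat using (ℕ; zero; suc; _+_; _*_; _≤_; _<_; z≤n; s≤s)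
open import Data.Nat.Properties
  using (module ≤-Reasoning; +-mono-≤; +-monoˡ-≤; +-suc; >⇒≢; <-≤-trans; m≤n⇒m≤1+n;
         n<1+n; m<n⇒m<1+n; m<1+n⇒m<n∨m≡n; m<n+m)
open import Data.Fin using (Fin; zero; suc; _≟_)
open import Data.Fin.Properties using (suc-injective; all?; any?; ¬∀⟶∃¬)
open import Data.Vec using (Vec; []; _∷_; _∷ʳ_; _++_)
open import Data.Bool using (Bool; true; false; not; _∧_)
open import Data.Bool.Properties using (¬-not) renaming (_≟_ to _≟ᵇ_)
open import Data.Product using (Σ; _×_; _,_; proj₁; proj₂)
open import Data.Sum using (inj₁; inj₂)
open import Function using (_∘_; case_of_)
open import Relation.Nullary using (¬_; Dec; does; yes; no; contradiction)
open import Relation.Nullary.Decidable using (_×-dec_; _→-dec_; ¬?)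
open import Relation.Binary.PropositionalEquality
  using (_≡_; _≢_; refl; sym; trans; cong; subst)

infix 4 _⊆ᵇ_
infixl 7 _∩ᵇ_ _∖ᵇ_

_⊆ᵇ_ : ∀ {N} → (Fin N → Bool) → (Fin N → Bool) → Set
P ⊆ᵇ Q = ∀ a → P a ≡ true → Q a ≡ true

Disjointᵇ : ∀ {N} → (Fin N → Bool) → (Fin N → Bool) → Set
Disjointᵇ P Q = ∀ a → ¬ (P a ≡ true × Q a ≡ true)

_∩ᵇ_ _∖ᵇ_ : ∀ {N} → (Fin N → Bool) → (Fin N → Bool) → Fin N → Bool
(P ∩ᵇ Q) a = P a ∧ Q a
(P ∖ᵇ Q) a = P a ∧ not (Q a)

-- The test comes first so that `true ∧ Q a` reduces to `Q a`: count-remove then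
-- holds by computation away from b.
remove : ∀ {N} → (Fin N → Bool) → Fin N → Fin N → Bool
remove Q b a = not (does (a ≟ b)) ∧ Q a

count-bounded : ∀ {N} (P : Fin N → Bool) → count P ≤ N
count-bounded {zero}  P = z≤n
count-bounded {suc N} P with P zero
... | true  = s≤s (count-bounded (P ∘ suc))
... | false = m≤n⇒m≤1+n (count-bounded (P ∘ suc))

count-witness : ∀ {N} (P : Fin N → Bool) a → P a ≡ true → 0 < count P
count-witness P zero    Pa rewrite Pa = s≤s z≤n
count-witness P (suc a) Pa with P zero
... | true  = s≤s z≤n
... | false = count-witness (P ∘ suc) a Pa

count-mono : ∀ {N} {P Q : Fin N → Bool} → P ⊆ᵇ Q → count P ≤ count Q
count-mono {zero}          P⊆Q = z≤n
count-mono {suc N} {P} {Q} P⊆Q with P zero in P₀ | Q zero in Q₀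
... | true  | true  = s≤s (count-mono (P⊆Q ∘ suc))
... | true  | false = contradiction (trans (sym (P⊆Q zero P₀)) Q₀) λ ()
... | false | true  = m≤n⇒m≤1+n (count-mono (P⊆Q ∘ suc))
... | false | false = count-mono (P⊆Q ∘ suc)

count-split : ∀ {N} (S P : Fin N → Bool) →
  count S ≡ count (S ∩ᵇ P) + count (S ∖ᵇ P)
count-split {zero}  S P = refl
count-split {suc N} S P with S zero | P zero
... | false | _     = count-split (S ∘ suc) (P ∘ suc)
... | true  | true  = cong suc (count-split (S ∘ suc) (P ∘ suc))
... | true  | false = trans (cong suc (count-split (S ∘ suc) (P ∘ suc))) (sym (+-suc _ _))

count-remove : ∀ {N} (Q : Fin N → Bool) b → Q b ≡ true → count Q ≡ suc (count (remove Q b))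
count-remove Q zero    Qb rewrite Qb = refl
count-remove Q (suc b) Qb with Q zero
... | true  = cong suc (count-remove (Q ∘ suc) b Qb)
... | false = count-remove (Q ∘ suc) b Qb

remove-true : ∀ {N} (Q : Fin N → Bool) {a b} → Q a ≡ true → a ≢ b → remove Q b a ≡ true
remove-true Q {a} {b} Qa a≢b with a ≟ b
... | yes a≡b = contradiction a≡b a≢b
... | no  _   = Qa

InjectiveOn : ∀ {N M} → (Fin N → Bool) → (Fin N → Fin M) → Set
InjectiveOn P f = ∀ a a' → P a ≡ true → P a' ≡ true → f a ≡ f a' → a ≡ a'

injectiveOn-suc : ∀ {N M} {P : Fin (suc N) → Bool} {f : Fin (suc N) → Fin M} →
  InjectiveOn P f → InjectiveOn (P ∘ suc) (f ∘ suc)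
injectiveOn-suc inj a a' Pa Pa' fa≡fa' = suc-injective (inj (suc a) (suc a') Pa Pa' fa≡fa')

count-≤-injection : ∀ {N M} {P : Fin N → Bool} {Q : Fin M → Bool} (f : Fin N → Fin M) →
  (∀ a → P a ≡ true → Q (f a) ≡ true) → InjectiveOn P f → count P ≤ count Q
count-≤-injection {zero}          f maps inj = z≤n
count-≤-injection {suc N} {P = P} {Q} f maps inj with P zero in P₀
... | false = count-≤-injection (f ∘ suc) (maps ∘ suc) (injectiveOn-suc inj)
... | true  = subst (suc (count (P ∘ suc)) ≤_) (sym (count-remove Q (f zero) (maps zero P₀)))
                (s≤s (count-≤-injection (f ∘ suc) maps-removed (injectiveOn-suc inj)))
  where
    maps-removed : ∀ a → P (suc a) ≡ true → remove Q (f zero) (f (suc a)) ≡ true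
    maps-removed a Pa = remove-true Q (maps (suc a) Pa)
      λ fa≡f₀ → case inj zero (suc a) P₀ Pa (sym fa≡f₀) of λ ()

count-≤-relation : ∀ {N} {P Q : Fin N → Bool} (R : Fin N → Fin N → Bool) →
  (∀ a → P a ≡ true → Σ (Fin N) λ b → R a b ≡ true) →
  (∀ a b → R a b ≡ true → Q b ≡ true) →
  (∀ a a' b → R a b ≡ true → R a' b ≡ true → a ≡ a') →
  count P ≤ count Q
count-≤-relation {N} {P} {Q} R total into injective =
  count-≤-injection f (λ a Pa → into a (f a) (related a Pa))
    (λ a a' Pa Pa' fa≡fa' → injective a a' (f a) (related a Pa)
                              (subst (λ b → R a' b ≡ true) (sym fa≡fa') (related a' Pa')))
  where
    chosen : ∀ a → Σ (Fin N) (λ b → P a ≡ true → R a b ≡ true)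
    chosen a with P a ≟ᵇ true
    ... | yes Pa = proj₁ (total a Pa) , λ _ → proj₂ (total a Pa)
    ... | no ¬Pa = a , λ Pa → contradiction Pa ¬Pa
    f : Fin N → Fin N
    f = proj₁ ∘ chosen
    related : ∀ a → P a ≡ true → R a (f a) ≡ true
    related = proj₂ ∘ chosen

count-disjoint-family : ∀ {N} (Q : ℕ → Fin N → Bool) {S : Fin N → Bool} {A} (m : ℕ) →
  (∀ j → j < m → Q j ⊆ᵇ S) → (∀ j → j < m → A ≤ count (Q j)) →
  (∀ j → j < m → ∀ j' → j' < j → Disjointᵇ (Q j) (Q j')) →
  m * A ≤ count S
count-disjoint-family Q zero _ _ _ = z≤n
count-disjoint-family Q {S} {A} (suc m) ⊆S large disjoint = begin
  A + m * A                           ≤⟨ +-mono-≤ (large m (n<1+n m)) rest ⟩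
  count (Q m) + count (S ∖ᵇ Q m)      ≤⟨ +-monoˡ-≤ _ (count-mono Qm⊆S∩Qm) ⟩
  count (S ∩ᵇ Q m) + count (S ∖ᵇ Q m) ≡⟨ count-split S (Q m) ⟨
  count S                             ∎
  where
    open ≤-Reasoning

    Qm⊆S∩Qm : Q m ⊆ᵇ S ∩ᵇ Q m
    Qm⊆S∩Qm a Qma = trans (cong (_∧ Q m a) (⊆S m (n<1+n m) a Qma)) Qma

    Qj⊆S∖Qm : ∀ j → j < m → Q j ⊆ᵇ S ∖ᵇ Q m
    Qj⊆S∖Qm j j<m a Qja
      rewrite ⊆S j (m<n⇒m<1+n j<m) a Qja
            | ¬-not {Q m a} {true} (λ Qma → disjoint m (n<1+n m) j j<m a (Qma , Qja)) = refl

    rest : m * A ≤ count (S ∖ᵇ Q m)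
    rest = count-disjoint-family Q m Qj⊆S∖Qm
             (λ j → large j ∘ m<n⇒m<1+n) (λ j → disjoint j ∘ m<n⇒m<1+n)

module UltrafilterProperties {I : Set} (F : Ultrafilter I) where

  most-map : {A B : I → Set} → (∀ i → A i → B i) → Big F A → Big F B
  most-map = upward F _ _

  most-× : {A B : I → Set} → Big F A → Big F B → Big F (λ i → A i × B i)
  most-× = inter F _ _

  most-zip : {A B C : I → Set} → (∀ i → A i → B i → C i) → Big F A → Big F B → Big F C
  most-zip f A B = most-map (λ i (a , b) → f i a b) (most-× A B)

  most-→ : {A B : I → Set} → (Big F A → Big F B) → Big F (λ i → A i → B i)
  most-→ {A} {B} f with ultra F A
  ... | inj₁ most-A  = most-map (λ i b _ → b) (f most-A)
  ... | inj₂ most-¬A = most-map (λ i ¬a a → contradiction a ¬a) most-¬A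

  most-¬ : {A : I → Set} → ¬ Big F A → Big F (λ i → ¬ A i)
  most-¬ {A} ¬most-A with ultra F A
  ... | inj₁ most-A  = contradiction most-A ¬most-A
  ... | inj₂ most-¬A = most-¬A

  most-∀< : (G : ℕ → I → Set) (m : ℕ) →
    (∀ j → j < m → Big F (G j)) → Big F (λ i → ∀ j → j < m → G j i)
  most-∀< G zero    most-G = most-map (λ i _ j ()) (whole F)
  most-∀< G (suc m) most-G =
    most-zip below-suc (most-∀< G m (λ j → most-G j ∘ m<n⇒m<1+n)) (most-G m (n<1+n m))
    where
      below-suc : ∀ i → (∀ j → j < m → G j i) → G m i → ∀ j → j < suc m → G j i
      below-suc i G<m Gm j j<1+m with m<1+n⇒m<n∨m≡n j<1+m
      ... | inj₁ j<m  = G<m j j<m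
      ... | inj₂ refl = Gm

module Łoś {I : Set} (F : Ultrafilter I) (Ms : I → Str) where
  open Ultraproduct F Ms
  open UltrafilterProperties F

  most-∀ : (Q : ∀ i → Carrier (Ms i) → Set) → (∀ i a → Dec (Q i a)) →
    (∀ (x : Elem) → Most (λ i → Q i (x i))) → Most (λ i → ∀ a → Q i a)
  most-∀ Q Q? holds =
    most-map (λ i → proj₂ (counterexample i)) (holds (λ i → proj₁ (counterexample i)))
    where
      counterexample : ∀ i → Σ (Carrier (Ms i)) λ a → Q i a → ∀ b → Q i b
      counterexample i with all? (Q? i)
      ... | yes ∀Q = zero , λ _ → ∀Q
      ... | no ¬∀Q = let (a , ¬Qa) = ¬∀⟶∃¬ _ (Q i) (Q? i) ¬∀Q in
                     a , λ Qa → contradiction Qa ¬Qa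

  most-∀² : (Q : ∀ i → Carrier (Ms i) → Carrier (Ms i) → Set) →
    (∀ i a b → Dec (Q i a b)) →
    (∀ (x y : Elem) → Most (λ i → Q i (x i) (y i))) → Most (λ i → ∀ a b → Q i a b)
  most-∀² Q Q? holds =
    most-∀ (λ i a → ∀ b → Q i a b) (λ i a → all? (Q? i a))
      (λ x → most-∀ (λ i → Q i (x i)) (λ i → Q? i (x i)) (holds x))

  most-∀³ : (Q : ∀ i → Carrier (Ms i) → Carrier (Ms i) → Carrier (Ms i) → Set) →
    (∀ i a b c → Dec (Q i a b c)) →
    (∀ (x y z : Elem) → Most (λ i → Q i (x i) (y i) (z i))) →
    Most (λ i → ∀ a b c → Q i a b c)
  most-∀³ Q Q? holds =
    most-∀ (λ i a → ∀ b c → Q i a b c) (λ i a → all? λ b → all? (Q? i a b))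
      (λ x → most-∀² (λ i → Q i (x i)) (λ i → Q? i (x i)) (holds x))

subst-∷ʳ-++ : ∀ {A : Set} (P : ∀ {n} → Vec A n → Set) {k} (σ : Vec A k) j →
  P (σ ∷ʳ j) → P (σ ++ j ∷ [])
subst-∷ʳ-++ P []      j = λ p → p
subst-∷ʳ-++ P (x ∷ σ) j = subst-∷ʳ-++ (λ τ → P (x ∷ τ)) σ j

initSeg-suc : ∀ h k → initSeg h (suc k) ≡ initSeg h k ∷ʳ h k
initSeg-suc h zero    = refl
initSeg-suc h (suc k) = cong (h 0 ∷_) (initSeg-suc (h ∘ suc) k)

module TreeModel {I : Set} (F : Ultrafilter I) (Ms : I → Str) (T : Ultraproduct.ModelsT F Ms) where
  open Ultraproduct F Ms
  open ModelsT T
  open UltrafilterProperties F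
  open Łoś F Ms
  open Definability F Ms

  UM-∷ʳ : ∀ {k} (σ : Vec ℕ k) j x → UM (σ ∷ʳ j) x → UM σ x
  UM-∷ʳ σ j x = ax-c σ (j ∷ []) x ∘ subst-∷ʳ-++ (λ τ → UM τ x) σ j

  child-⊆ : ∀ {k} (σ : Vec ℕ k) j → Most (λ i → U (Ms i) (σ ∷ʳ j) ⊆ᵇ U (Ms i) σ)
  child-⊆ σ j = most-∀ _ (λ i a → (U (Ms i) (σ ∷ʳ j) a ≟ᵇ true) →-dec (U (Ms i) σ a ≟ᵇ true))
                  (λ x → most-→ (UM-∷ʳ σ j x))

  children-disjoint : ∀ {k} (σ : Vec ℕ k) {j j'} → j ≢ j' →
    Most (λ i → Disjointᵇ (U (Ms i) (σ ∷ʳ j)) (U (Ms i) (σ ∷ʳ j')))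
  children-disjoint σ {j} {j'} j≢j' =
    most-∀ _ (λ i a → ¬? ((U (Ms i) (σ ∷ʳ j) a ≟ᵇ true) ×-dec
                           (U (Ms i) (σ ∷ʳ j') a ≟ᵇ true)))
      λ x → most-¬ λ both →
        ax-d σ j j' j≢j' x (most-map (λ _ → proj₁) both , most-map (λ _ → proj₂) both)

  cardU-pos : ∀ {k} (τ : Vec ℕ k) → Most (λ i → 0 < cardU (Ms i) τ)
  cardU-pos τ = let (x , x∈τ) = ax-b τ in
                most-map (λ i → count-witness (U (Ms i) τ) (x i)) x∈τ

  cardU-≤ : ∀ {k} (τ τ' : Vec ℕ k) → Most (λ i → cardU (Ms i) τ ≤ cardU (Ms i) τ')
  cardU-≤ τ τ' = most-zip (λ i (total , into) → count-≤-relation (B (Ms i) τ τ') total into)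
                   (most-× total into) injective
    where
      B? : ∀ i a b → Dec (B (Ms i) τ τ' a b ≡ true)
      B? i a b = B (Ms i) τ τ' a b ≟ᵇ true

      total : Most (λ i → ∀ a → U (Ms i) τ a ≡ true →
                          Σ (Carrier (Ms i)) λ b → B (Ms i) τ τ' a b ≡ true)
      total = most-∀ _ (λ i a → (U (Ms i) τ a ≟ᵇ true) →-dec any? (B? i a))
        λ x → most-→ λ x∈τ → let (y , Bxy) = ax-e-tot τ τ' x x∈τ in
                             most-map (λ i Bxyᵢ → y i , Bxyᵢ) Bxy

      into : Most (λ i → ∀ a b → B (Ms i) τ τ' a b ≡ true → U (Ms i) τ' b ≡ true)
      into = most-∀² _ (λ i a b → B? i a b →-dec (U (Ms i) τ' b ≟ᵇ true))
        λ x y → most-→ (proj₂ ∘ ax-e-dom τ τ' x y)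

      injective : Most (λ i → ∀ a a' b →
                              B (Ms i) τ τ' a b ≡ true → B (Ms i) τ τ' a' b ≡ true → a ≡ a')
      injective = most-∀³ _ (λ i a a' b → B? i a b →-dec B? i a' b →-dec a ≟ a')
        λ x x' y → most-→ λ Bxy → most-→ (ax-e-inj τ τ' x x' y Bxy)

  cardU-children : ∀ {k} (σ : Vec ℕ k) c m →
    Most (λ i → m * cardU (Ms i) (σ ∷ʳ c) ≤ cardU (Ms i) σ)
  cardU-children σ c m =
    most-zip (λ i (⊆σ , large) → count-disjoint-family (λ j → U (Ms i) (σ ∷ʳ j)) m ⊆σ large)
      (most-× (most-∀< _ m λ j _ → child-⊆ σ j)
              (most-∀< _ m λ j _ → cardU-≤ (σ ∷ʳ c) (σ ∷ʳ j)))
      (most-∀< _ m λ j _ → most-∀< _ j λ j' j'<j → children-disjoint σ (>⇒≢ j'<j))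

  cardU-child< : ∀ {k} (σ : Vec ℕ k) c n →
    Most (λ i → n * cardU (Ms i) (σ ∷ʳ c) < cardU (Ms i) σ)
  cardU-child< σ c n =
    most-zip (λ i pos → <-≤-trans (m<n+m _ pos)) (cardU-pos (σ ∷ʳ c)) (cardU-children σ c (suc n))

  initSeg-δ< : ∀ h k →
    δ< (λ i → cardU (Ms i) (initSeg h (suc k))) (λ i → cardU (Ms i) (initSeg h k))
  initSeg-δ< h k n rewrite initSeg-suc h k = cardU-child< (initSeg h k) (h k) n

  initSegSet : (ℕ → ℕ) → ℕ → Definable
  initSegSet h k = record { arity = 0 ; φ = rel-U (initSeg h k) zero ; params = λ () }

  initSegSet-⊇ : ∀ h k x → x ∈D initSegSet h (suc k) → x ∈D initSegSet h k
  initSegSet-⊇ h k x = UM-∷ʳ (initSeg h k) (h k) x ∘ subst (λ τ → UM τ x) (initSeg-suc h k)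

  ¬SA : (ℕ → ℕ) → ¬ SA
  ¬SA h sa = sa (initSegSet h , initSegSet-⊇ h , initSeg-δ< h)

proposition3p5 : (I : Set) (F : Ultrafilter I) (Ms : I → Str) →
    Ultraproduct.ModelsT F Ms → (h : ℕ → ℕ) →
    Ultraproduct.δ< F Ms (λ i → cardU (Ms i) (initSeg h 1)) (λ i → card (Ms i)) ×
    (∀ (n : ℕ) → Ultraproduct.δ< F Ms (λ i → cardU (Ms i) (initSeg h (suc (suc n))))
                                      (λ i → cardU (Ms i) (initSeg h (suc n)))) ×
    ¬ Definability.SA F Ms
proposition3p5 I F Ms T h =
  (λ n → most-map (λ i n|U₁|<|U₀| → <-≤-trans n|U₁|<|U₀| (count-bounded (U (Ms i) [])))
                  (initSeg-δ< h 0 n)) ,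
  (λ n → initSeg-δ< h (suc n)) ,
  ¬SA h
  where
    open TreeModel F Ms T
    open UltrafilterProperties F
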